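{- Let $n\ge 2$ and $M\subseteq[0,n-1]$. Then $$\sum_{\{\gamma\in D_n\mid\operatorname{Des}_D(\gamma^{ -1})=M\}} q^{\operatorname{dmaj}(\gamma)}=\sum_{\{\gamma\in D_n\mid\operatorname{Des}_D(\gamma^{ -1})=M\}} q^{\ell_D(\gamma)}.$$
   Context: $B_n$ is the group of bijections $\beta$ of $[-n,n]\setminus\{0\}$ with $\beta(-i)=-\beta(i)$, composed as functions, in window notation $[\beta(1),\dots,\beta(n)]$; $D_n\subseteq B_n$ is the subgroup of those with an even number of negative entries among $\beta(1),\dots,\beta(n)$. For $\gamma\in D_n$: $\operatorname{Des}_D(\gamma)=\{i\in[0,n-1]\mid\gamma(i)>\gamma(i+1)\}$ with $\gamma(0):=-\gamma(2)$; $\operatorname{Des}(\gamma)=\{i\in[n-1]\mid\gamma(i)>\gamma(i+1)\}$, $\operatorname{maj}(\gamma)=\sum_{i\in\operatorname{Des}(\gamma)}i$; $\operatorname{inv}(\gamma)=|\{(i,j):1\le i<j\le n,\gamma(i)>\gamma(j)\}|$; $\operatorname{N}_2(\gamma)=|\{\{i,j\}\subseteq[n],i\ne j:\gamma(i)+\gamma(j)<0\}|$. $\ell_D(\gamma)=\operatorname{inv}(\gamma)+\operatorname{N}_2(\gamma)$ and $\operatorname{dmaj}(\gamma)=\operatorname{maj}(\gamma)+\operatorname{N}_2(\gamma)$. -}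

module Defs where

open import Data.Bool using (Bool; true; false; if_then_else_; _∧_; not)
open import Data.Nat as ℕ using (ℕ; zero; suc; _≟_)
open import Data.Nat.Properties using ()
open import Data.Integer as ℤ using (ℤ; +_; -[1+_]; -_; ∣_∣; _<?_)
open import Data.Fin using (Fin; toℕ)
open import Data.Fin.Subset using (Subset; inside; outside)
open import Data.List using (List; []; _∷_; map; _++_; concatMap; filterᵇ; filter; length; upTo)
open import Data.Nat.ListAction using (sum)
open import Data.Vec using (tabulate)
import Data.Vec.Properties as VecP
import Data.Bool.Properties as BoolP
open import Relation.Nullary.Decidable using (⌊_⌋)
open import Relation.Binary.PropositionalEquality using (_≡_)

-- Signed permutations in window notation [β(1),…,β(n)] as lists of integers.
Window : Set
Window = List ℤ

vals : ℕ → List ℤ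
vals n = map (λ i → + suc i) (upTo n) ++ map (λ i → -[1+ i ]) (upTo n)

words : ℕ → ℕ → List Window
words n zero    = [] ∷ []
words n (suc m) = concatMap (λ w → map (λ x → x ∷ w) (vals n)) (words n m)

_==ℕ_ : ℕ → ℕ → Bool
a ==ℕ b = ⌊ a ≟ b ⌋

infix 4 _<ℤ_ _==ℕ_
_<ℤ_ : ℤ → ℤ → Bool
a <ℤ b = ⌊ a <? b ⌋

elemℕ : ℕ → List ℕ → Bool
elemℕ a []       = false
elemℕ a (b ∷ bs) = if a ==ℕ b then true else elemℕ a bs

distinctℕ : List ℕ → Bool
distinctℕ []       = true
distinctℕ (a ∷ as) = not (elemℕ a as) ∧ distinctℕ as

Bn : ℕ → List Window
Bn n = filterᵇ (λ w → distinctℕ (map ∣_∣ w)) (words n n)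

negs : Window → ℕ
negs []       = 0
negs (x ∷ xs) = (if x <ℤ (+ 0) then 1 else 0) ℕ.+ negs xs

isEven : ℕ → Bool
isEven zero          = true
isEven (suc zero)    = false
isEven (suc (suc k)) = isEven k

Dn : ℕ → List Window
Dn n = filterᵇ (λ w → isEven (negs w)) (Bn n)

-- γ(i) for 1 ≤ i ≤ length (1-based; 0 outside the range, never used there)
at : Window → ℕ → ℤ
at []       _             = + 0
at (x ∷ xs) zero          = + 0
at (x ∷ xs) (suc zero)    = x
at (x ∷ xs) (suc (suc i)) = at xs (suc i)

-- γ⁻¹(j): the signed position of ±j in the window (position counter starts at i)
invAt : Window → ℕ → ℕ → ℤ
invAt []       j i = + 0
invAt (x ∷ xs) j i =
  if ⌊ x ℤ.≟ + j ⌋ then + i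
  else if ⌊ x ℤ.≟ - (+ j) ⌋ then - (+ i)
  else invAt xs j (suc i)

inverse : ℕ → Window → Window
inverse n w = map (λ j → invAt w (suc j) 1) (upTo n)

-- descent of type D at position i ∈ [0, n-1], with γ(0) := -γ(2)
desDAt : Window → ℕ → Bool
desDAt w zero    = at w 1 <ℤ (- at w 2)
desDAt w (suc i) = at w (suc (suc i)) <ℤ at w (suc i)

-- Des_D(γ) ⊆ [0, n-1], as a subset of Fin n (index i ↔ element i)
DesD : (n : ℕ) → Window → Subset n
DesD n w = tabulate (λ (i : Fin n) → if desDAt w (toℕ i) then inside else outside)

maj : ℕ → Window → ℕ
maj n w = sum (map (λ k → if at w (suc (suc k)) <ℤ at w (suc k) then suc k else 0)
                   (upTo (n ℕ.∸ 1)))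

inv : Window → ℕ
inv []       = 0
inv (x ∷ xs) = length (filterᵇ (λ y → y <ℤ x) xs) ℕ.+ inv xs

N2 : Window → ℕ
N2 []       = 0
N2 (x ∷ xs) = length (filterᵇ (λ y → (x ℤ.+ y) <ℤ (+ 0)) xs) ℕ.+ N2 xs

ℓD : Window → ℕ
ℓD w = inv w ℕ.+ N2 w

dmaj : ℕ → Window → ℕ
dmaj n w = maj n w ℕ.+ N2 w

DnWithInvDes : (n : ℕ) → Subset n → List Window
DnWithInvDes n M = filter (λ γ → VecP.≡-dec BoolP._≟_ (DesD n (inverse n γ)) M) (Dn n)

-- coefficient of q^k in  Σ_{γ ∈ S} q^{stat γ}
coeff : List Window → (Window → ℕ) → ℕ → ℕ
coeff S stat k = length (filterᵇ (λ γ → stat γ ==ℕ k) S)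

module Submission where

-- The D_n equidistribution  Σ q^dmaj = Σ q^ℓ_D  over {γ ∈ D_n | Des_D(γ⁻¹) = M}, proved
-- bijectively with Foata's second fundamental transformation θ = foata on words over ℤ.  θ is
-- implemented on the reversed word, where letters are inserted at the front and the "Foata
-- blocks" of the rest are rotated.  After generic counting facts, the file proves for all words w:
--   (1) θ w is a rearrangement of w, and θ has an explicit two-sided inverse foata⁻¹;
--   (2) inv (θ w) = maj w  (Foata's theorem, from its reversed form invRev ∘ foataRev = majRev);
--   (3) if no letter of w lies strictly between a and b, θ keeps a and b in their relative order.
-- For signed permutations, the entries of γ⁻¹ are signed positions of ±j in γ, and each D-descent
-- of γ⁻¹ compares the positions of two values with no entry of γ between them: (j, j+1),
-- (−j−1, −j), and (1, −2) or (2, −1) at position 0.  So by (3) Des_D((θ γ)⁻¹) = Des_D(γ⁻¹), by (1)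
-- θ preserves D_n and N₂, and by (2) ℓ_D(θ γ) = dmaj(γ).  Hence θ permutes
-- {γ ∈ D_n | Des_D(γ⁻¹) = M} carrying dmaj to ℓ_D, and the theorem follows by counting along θ.

open import Defs
open import Function using (_∘_)
open import Data.Bool using (Bool; true; false; if_then_else_; _∨_; not; T)
open import Data.Bool.Properties using (T?)
import Data.Bool.Properties as BoolP
open import Data.Unit using (tt)
open import Data.Nat as ℕ using (ℕ; zero; suc; _+_; _≤_; _<_; _<ᵇ_; s≤s; z≤n)
import Data.Nat.Properties as NP
open import Data.Nat.ListAction using (sum)
open import Data.Integer as ℤ using (ℤ; +_; -[1+_]; -_; ∣_∣; +<+; -<-)
import Data.Integer.Properties as ZP
open import Data.List using (List; []; _∷_; map; _++_; filterᵇ; length; reverse; upTo; applyUpTo; _∷ʳ_; concatMap)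
import Data.List.Properties as LP
open import Data.List.Relation.Binary.Permutation.Propositional using (_↭_; prep; swap; ↭-sym; ↭-reflexive; ↭⇒↭ₛ) renaming (refl to ↭-refl; trans to ↭-trans)
import Data.List.Relation.Binary.Permutation.Propositional.Properties as PP
import Data.List.Relation.Binary.Permutation.Setoid.Properties as PermSetoid
open import Data.List.Relation.Unary.All using (All; []; _∷_)
import Data.List.Relation.Unary.All as All
import Data.List.Relation.Unary.All.Properties as AllP
open import Data.List.Relation.Unary.Any using (here; there)
open import Data.List.Membership.Propositional using (_∈_; _∉_)
import Data.List.Membership.Propositional.Properties as MP
import Data.List.Relation.Unary.Any.Properties as AnyP
open import Data.List.Relation.Unary.Unique.Propositional using (Unique)
import Data.List.Relation.Unary.Unique.Propositional.Properties as UP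
open import Data.List.Relation.Unary.AllPairs using ([]; _∷_)
open import Relation.Binary.PropositionalEquality using (_≡_; _≢_; refl; sym; trans; cong; cong₂; subst; setoid; module ≡-Reasoning)
open import Relation.Nullary.Decidable using (⌊_⌋; yes; no)
open import Relation.Nullary using (¬_)
open import Data.Empty using (⊥; ⊥-elim)
open import Data.Product using (Σ; _×_; _,_; proj₁)
open import Data.Sum using (inj₁; inj₂)
open import Data.Fin using (toℕ)
import Data.Fin.Properties as FP
import Data.Vec.Properties as VecP
open import Data.Fin.Subset using (Subset; inside; outside)
open import Data.Nat.Tactic.RingSolver using (solve-∀)

false≢true : false ≢ true
false≢true ()

<ℤ-true⇒< : ∀ {a b} → (a <ℤ b) ≡ true → a ℤ.< b
<ℤ-true⇒< {a} {b} h with a ℤ.<? b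
... | yes a<b = a<b
... | no _ = ⊥-elim (false≢true h)

<ℤ-false⇒≥ : ∀ {a b} → (a <ℤ b) ≡ false → b ℤ.≤ a
<ℤ-false⇒≥ {a} {b} h with a ℤ.<? b
... | yes _ = ⊥-elim (false≢true (sym h))
... | no a≮b = ZP.≮⇒≥ a≮b

<⇒<ℤ-true : ∀ {a b} → a ℤ.< b → (a <ℤ b) ≡ true
<⇒<ℤ-true {a} {b} a<b with a ℤ.<? b
... | yes _ = refl
... | no a≮b = ⊥-elim (a≮b a<b)

≥⇒<ℤ-false : ∀ {a b} → b ℤ.≤ a → (a <ℤ b) ≡ false
≥⇒<ℤ-false {a} {b} b≤a with a ℤ.<? b
... | yes a<b = ⊥-elim (ZP.≤⇒≯ b≤a a<b)
... | no _ = refl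

T⇒≡true : ∀ {b} → T b → b ≡ true
T⇒≡true {true} _ = refl

module _ {A : Set} where

  countᵇ : (A → Bool) → List A → ℕ
  countᵇ p l = length (filterᵇ p l)

  count-↭ : ∀ p {l l' : List A} → l ↭ l' → countᵇ p l ≡ countᵇ p l'
  count-↭ p q = PP.↭-length (PP.filter-↭ (T? ∘ p) q)

  count-++ : ∀ p (u v : List A) → countᵇ p (u ++ v) ≡ countᵇ p u + countᵇ p v
  count-++ p u v = trans (cong length (LP.filter-++ (T? ∘ p) u v)) (LP.length-++ (filterᵇ p u))

  count-∷-true : ∀ p x (l : List A) → p x ≡ true → countᵇ p (x ∷ l) ≡ suc (countᵇ p l)
  count-∷-true p x l px rewrite px = refl

  count-∷-false : ∀ p x (l : List A) → p x ≡ false → countᵇ p (x ∷ l) ≡ countᵇ p l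
  count-∷-false p x l px rewrite px = refl

  count-∷ : ∀ p x (l : List A) → countᵇ p (x ∷ l) ≡ (if p x then 1 else 0) + countᵇ p l
  count-∷ p x l with p x
  ... | true = refl
  ... | false = refl

  count-complement : ∀ p (l : List A) → countᵇ p l + countᵇ (not ∘ p) l ≡ length l
  count-complement p [] = refl
  count-complement p (x ∷ l) with p x
  ... | true = cong suc (count-complement p l)
  ... | false = trans (NP.+-suc (countᵇ p l) _) (cong suc (count-complement p l))

  Unique⊆⇒length≤ : ∀ (xs ys : List A) → Unique xs → (∀ {x} → x ∈ xs → x ∈ ys) → length xs ≤ length ys
  Unique⊆⇒length≤ [] ys u h = z≤n
  Unique⊆⇒length≤ (x ∷ xs) ys (x∉xs ∷ u) h with MP.∈-∃++ (h (here refl))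
  ... | ys₁ , ys₂ , refl = subst (suc (length xs) ≤_) (sym (PP.↭-length (PP.shift x ys₁ ys₂)))
        (s≤s (Unique⊆⇒length≤ xs (ys₁ ++ ys₂) u xs⊆))
    where
    xs⊆ : ∀ {z} → z ∈ xs → z ∈ ys₁ ++ ys₂
    xs⊆ {z} z∈ with PP.∈-resp-↭ (PP.shift x ys₁ ys₂) (h (there z∈))
    ... | here refl = ⊥-elim (All.lookup x∉xs z∈ refl)
    ... | there q = q

  Unique-↭ : ∀ {l l' : List A} → l ↭ l' → Unique l → Unique l'
  Unique-↭ p = PermSetoid.Unique-resp-↭ (setoid A) (↭⇒↭ₛ p)

  filter-cong : ∀ (p q : A → Bool) xs → (∀ x → x ∈ xs → p x ≡ q x) → filterᵇ p xs ≡ filterᵇ q xs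
  filter-cong p q [] h = refl
  filter-cong p q (x ∷ xs) h rewrite h x (here refl) with q x
  ... | true = cong (x ∷_) (filter-cong p q xs (λ y y∈ → h y (there y∈)))
  ... | false = filter-cong p q xs (λ y y∈ → h y (there y∈))

  ∈-filterᵇ⁻ : ∀ (p : A → Bool) {x} xs → x ∈ filterᵇ p xs → x ∈ xs × p x ≡ true
  ∈-filterᵇ⁻ p xs h with MP.∈-filter⁻ (T? ∘ p) h
  ... | x∈ , px = x∈ , T⇒≡true px

  ∈-filterᵇ⁺ : ∀ (p : A → Bool) {x} xs → x ∈ xs → p x ≡ true → x ∈ filterᵇ p xs
  ∈-filterᵇ⁺ p xs x∈ px = MP.∈-filter⁺ (T? ∘ p) x∈ (subst T (sym px) tt)

  count-bijection : ∀ (f g : A → A) → (∀ x → g (f x) ≡ x) → (∀ x → f (g x) ≡ x) →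
    ∀ (S : List A) (P : A → Bool) → Unique S → (∀ {x} → x ∈ S → f x ∈ S) → (∀ {x} → x ∈ S → g x ∈ S) →
    countᵇ (P ∘ f) S ≡ countᵇ P S
  count-bijection f g gf fg S P uS f∈ g∈ =
    NP.≤-antisym (transport f (P ∘ f) P (λ e → trans (sym (gf _)) (trans (cong g e) (gf _))) f∈ (λ x Pfx → Pfx))
                 (transport g P (P ∘ f) (λ e → trans (sym (fg _)) (trans (cong f e) (fg _))) g∈
                    (λ x Px → trans (cong P (fg x)) Px))
    where
    transport : ∀ (h : A → A) (Q R : A → Bool) → (∀ {x y} → h x ≡ h y → x ≡ y) →
      (∀ {x} → x ∈ S → h x ∈ S) → (∀ x → Q x ≡ true → R (h x) ≡ true) → countᵇ Q S ≤ countᵇ R S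
    transport h Q R inj h∈ QR = subst (_≤ countᵇ R S) (LP.length-map h (filterᵇ Q S))
      (Unique⊆⇒length≤ (map h (filterᵇ Q S)) (filterᵇ R S) (UP.map⁺ inj (UP.filter⁺ (T? ∘ Q) uS)) image⊆)
      where
      image⊆ : ∀ {y} → y ∈ map h (filterᵇ Q S) → y ∈ filterᵇ R S
      image⊆ y∈ with MP.∈-map⁻ h y∈
      ... | x , x∈ , refl with ∈-filterᵇ⁻ Q S x∈
      ...   | x∈S , Qx = ∈-filterᵇ⁺ R S (h∈ x∈S) (QR x Qx)

-- For a letter x and a word c ∷ u, the Foata
-- blocks of c ∷ u are the maximal segments starting with a letter on the same side of x as c
-- (above x, or not above x) followed by letters on the other side; the step moves the first
-- letter of every block to the block's end.
sideOf : Bool → ℤ → ℤ → Bool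
sideOf true x z = x <ℤ z
sideOf false x z = not (x <ℤ z)

sameSide : ℤ → ℤ → ℤ → Bool
sameSide x c = sideOf (x <ℤ c) x

-- rotateBlocks p c u: c is the pending first letter of the current block; a letter passing p
-- closes the block (c is emitted) and becomes the new pending letter.
rotateBlocks : (ℤ → Bool) → ℤ → List ℤ → List ℤ
rotateBlocks p c [] = c ∷ []
rotateBlocks p c (z ∷ u) = if p z then c ∷ rotateBlocks p z u else z ∷ rotateBlocks p c u

foataStep : ℤ → List ℤ → List ℤ
foataStep x [] = []
foataStep x (c ∷ u) = rotateBlocks (sameSide x c) c u

foataRev : List ℤ → List ℤ
foataRev [] = []
foataRev (x ∷ r) = x ∷ foataStep x (foataRev r)

foata : List ℤ → List ℤ
foata w = reverse (foataRev (reverse w))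

-- The inverse: a letter passing p was the moved first letter of its block, so it goes back to
-- the front of the letters acc collected since the previous block.
unrotateBlocks : (ℤ → Bool) → List ℤ → List ℤ → List ℤ
unrotateBlocks p acc [] = acc
unrotateBlocks p acc (z ∷ u) =
  if p z then z ∷ (acc ++ unrotateBlocks p [] u) else unrotateBlocks p (acc ++ z ∷ []) u

lastOr : ℤ → List ℤ → ℤ
lastOr d [] = d
lastOr d (z ∷ u) = lastOr z u

-- the last letter of foataStep x (c ∷ u) is c, so it determines the side of the blocks
foataStep⁻¹ : ℤ → List ℤ → List ℤ
foataStep⁻¹ x l = unrotateBlocks (sameSide x (lastOr x l)) [] l

-- foataStep⁻¹ does not shrink its argument structurally, so recursion uses a length bound
foataRev⁻¹ : ℕ → List ℤ → List ℤ
foataRev⁻¹ zero l = l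
foataRev⁻¹ (suc f) [] = []
foataRev⁻¹ (suc f) (x ∷ u) = x ∷ foataRev⁻¹ f (foataStep⁻¹ x u)

foata⁻¹ : List ℤ → List ℤ
foata⁻¹ w = reverse (foataRev⁻¹ (length w) (reverse w))

rotateBlocks-↭ : ∀ p c u → rotateBlocks p c u ↭ c ∷ u
rotateBlocks-↭ p c [] = ↭-refl
rotateBlocks-↭ p c (z ∷ u) with p z
... | true = prep c (rotateBlocks-↭ p z u)
... | false = ↭-trans (prep z (rotateBlocks-↭ p c u)) (swap z c ↭-refl)

foataStep-↭ : ∀ x u → foataStep x u ↭ u
foataStep-↭ x [] = ↭-refl
foataStep-↭ x (c ∷ u) = rotateBlocks-↭ (sameSide x c) c u

foataRev-↭ : ∀ r → foataRev r ↭ r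
foataRev-↭ [] = ↭-refl
foataRev-↭ (x ∷ r) = prep x (↭-trans (foataStep-↭ x (foataRev r)) (foataRev-↭ r))

foata-↭ : ∀ w → foata w ↭ w
foata-↭ w = ↭-trans (PP.↭-reverse (foataRev (reverse w))) (↭-trans (foataRev-↭ (reverse w)) (PP.↭-reverse w))

unrotateBlocks-↭ : ∀ p (acc : List ℤ) u → unrotateBlocks p acc u ↭ acc ++ u
unrotateBlocks-↭ p acc [] = ↭-sym (↭-reflexive (LP.++-identityʳ acc))
unrotateBlocks-↭ p acc (z ∷ u) with p z
... | true = ↭-trans (prep z (PP.++⁺ˡ acc (unrotateBlocks-↭ p [] u))) (↭-sym (PP.shift z acc u))
... | false = ↭-trans (unrotateBlocks-↭ p (acc ++ z ∷ []) u) (↭-reflexive (LP.++-assoc acc (z ∷ []) u))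

sameSide-self : ∀ x c → sameSide x c c ≡ true
sameSide-self x c with x <ℤ c in eq
... | true = eq
... | false rewrite eq = refl

sameSide-accepted : ∀ x c e → sameSide x c e ≡ true → sameSide x e ≡ sameSide x c
sameSide-accepted x c e h with x <ℤ c
... | true with x <ℤ e
...   | true = refl
...   | false = ⊥-elim (false≢true h)
sameSide-accepted x c e h | false with x <ℤ e
...   | true = ⊥-elim (false≢true h)
...   | false = refl

-- (1b) foataStep⁻¹ undoes foataStep: unrotation inverts rotation, and the last letter of a
-- rotation passes the side test, so foataStep⁻¹ recovers the test used by foataStep.
unrotate-rotate : ∀ p c (acc : List ℤ) u → p c ≡ true → unrotateBlocks p acc (rotateBlocks p c u) ≡ c ∷ acc ++ u
unrotate-rotate p c acc [] pc rewrite pc = refl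
unrotate-rotate p c acc (z ∷ u) pc with p z in pz
... | true rewrite pc = cong (λ t → c ∷ acc ++ t) (unrotate-rotate p z [] u pz)
... | false rewrite pz = trans (unrotate-rotate p c (acc ++ z ∷ []) u pc) (cong (c ∷_) (LP.++-assoc acc (z ∷ []) u))

rotateBlocks-last : ∀ (p : ℤ → Bool) c (u : List ℤ) d → p c ≡ true → p (lastOr d (rotateBlocks p c u)) ≡ true
rotateBlocks-last p c [] d pc = pc
rotateBlocks-last p c (z ∷ u) d pc with p z in pz
... | true = rotateBlocks-last p z u c pz
... | false = rotateBlocks-last p c u z pc

foataStep⁻¹-foataStep : ∀ x v → foataStep⁻¹ x (foataStep x v) ≡ v
foataStep⁻¹-foataStep x [] = refl
foataStep⁻¹-foataStep x (c ∷ u) =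
  trans (cong (λ q → unrotateBlocks q [] (rotateBlocks (sameSide x c) c u))
              (sameSide-accepted x c _ (rotateBlocks-last (sameSide x c) c u x (sameSide-self x c))))
        (unrotate-rotate (sameSide x c) c [] u (sameSide-self x c))

rotateBlocks-skip : ∀ p c (acc : List ℤ) t → All (λ a → p a ≡ false) acc → rotateBlocks p c (acc ++ t) ≡ acc ++ rotateBlocks p c t
rotateBlocks-skip p c [] t [] = refl
rotateBlocks-skip p c (a ∷ acc) t (pa ∷ pacc) rewrite pa = cong (a ∷_) (rotateBlocks-skip p c acc t pacc)

unrotate-split : ∀ p (acc : List ℤ) z u → All (λ a → p a ≡ false) acc → p (lastOr z u) ≡ true →
  Σ ℤ λ c → Σ (List ℤ) λ w → (unrotateBlocks p acc (z ∷ u) ≡ c ∷ w) × (p c ≡ true) × (rotateBlocks p c w ≡ acc ++ z ∷ u)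
unrotate-split p acc z [] pacc plast rewrite plast = z , acc ++ [] , refl , plast , rotateBlocks-skip p z acc [] pacc
unrotate-split p acc z (y ∷ u) pacc plast with p z in pz
... | true with unrotate-split p [] y u [] plast
...   | c , w , e₁ , pc , e₂ = z , acc ++ c ∷ w , cong (λ t → z ∷ acc ++ t) e₁ , pz ,
        trans (rotateBlocks-skip p z acc (c ∷ w) pacc)
              (cong (acc ++_) (trans (cong (λ t → if t then z ∷ rotateBlocks p c w else c ∷ rotateBlocks p z w) pc)
                                     (cong (z ∷_) e₂)))
unrotate-split p acc z (y ∷ u) pacc plast | false with unrotate-split p (acc ++ z ∷ []) y u (AllP.++⁺ pacc (pz ∷ [])) plast
...   | c , w , e₁ , pc , e₂ = c , w , e₁ , pc , trans e₂ (LP.++-assoc acc (z ∷ []) (y ∷ u))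

foataStep-foataStep⁻¹ : ∀ x u → foataStep x (foataStep⁻¹ x u) ≡ u
foataStep-foataStep⁻¹ x [] = refl
foataStep-foataStep⁻¹ x (z ∷ u) with unrotate-split (sameSide x (lastOr z u)) [] z u [] (sameSide-self x (lastOr z u))
... | c , w , e₁ , pc , e₂ rewrite e₁ = trans (cong (λ q → rotateBlocks q c w) (sameSide-accepted x (lastOr z u) c pc)) e₂

length-foataStep⁻¹ : ∀ x u → length (foataStep⁻¹ x u) ≡ length u
length-foataStep⁻¹ x u = PP.↭-length (unrotateBlocks-↭ _ [] u)

foataRev⁻¹-foataRev : ∀ f r → length r ≤ f → foataRev⁻¹ f (foataRev r) ≡ r
foataRev⁻¹-foataRev zero [] _ = refl
foataRev⁻¹-foataRev (suc f) [] _ = refl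
foataRev⁻¹-foataRev (suc f) (x ∷ r) (s≤s r≤f) =
  cong (x ∷_) (trans (cong (foataRev⁻¹ f) (foataStep⁻¹-foataStep x (foataRev r))) (foataRev⁻¹-foataRev f r r≤f))

foataRev-foataRev⁻¹ : ∀ f u → length u ≤ f → foataRev (foataRev⁻¹ f u) ≡ u
foataRev-foataRev⁻¹ zero [] _ = refl
foataRev-foataRev⁻¹ (suc f) [] _ = refl
foataRev-foataRev⁻¹ (suc f) (x ∷ u) (s≤s u≤f) =
  cong (x ∷_) (trans (cong (foataStep x) (foataRev-foataRev⁻¹ f (foataStep⁻¹ x u) (subst (_≤ f) (sym (length-foataStep⁻¹ x u)) u≤f)))
                     (foataStep-foataStep⁻¹ x u))

foata⁻¹-foata : ∀ w → foata⁻¹ (foata w) ≡ w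
foata⁻¹-foata w = begin
  reverse (foataRev⁻¹ (length (foata w)) (reverse (reverse (foataRev (reverse w)))))
    ≡⟨ cong (λ t → reverse (foataRev⁻¹ (length (foata w)) t)) (LP.reverse-involutive (foataRev (reverse w))) ⟩
  reverse (foataRev⁻¹ (length (foata w)) (foataRev (reverse w)))
    ≡⟨ cong reverse (foataRev⁻¹-foataRev _ (reverse w) (NP.≤-reflexive length-rw)) ⟩
  reverse (reverse w)
    ≡⟨ LP.reverse-involutive w ⟩
  w ∎
  where
  open ≡-Reasoning
  length-rw : length (reverse w) ≡ length (foata w)
  length-rw = PP.↭-length (↭-trans (PP.↭-reverse w) (↭-sym (foata-↭ w)))

foata-foata⁻¹ : ∀ w → foata (foata⁻¹ w) ≡ w
foata-foata⁻¹ w = begin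
  reverse (foataRev (reverse (reverse (foataRev⁻¹ (length w) (reverse w)))))
    ≡⟨ cong (λ t → reverse (foataRev t)) (LP.reverse-involutive (foataRev⁻¹ (length w) (reverse w))) ⟩
  reverse (foataRev (foataRev⁻¹ (length w) (reverse w)))
    ≡⟨ cong reverse (foataRev-foataRev⁻¹ (length w) (reverse w) (NP.≤-reflexive (LP.length-reverse w))) ⟩
  reverse (reverse w)
    ≡⟨ LP.reverse-involutive w ⟩
  w ∎
  where open ≡-Reasoning

-- Since foata works on reversed words, its statistics are read on
-- reversed words: invRev l counts pairs i < j with l_i < l_j (the inversions of reverse l),
-- and majRev l weights an ascent of l followed by r letters by r + 1 (the major index of reverse l).
invRev : List ℤ → ℕ
invRev [] = 0
invRev (x ∷ u) = countᵇ (x <ℤ_) u + invRev u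

majRev : List ℤ → ℕ
majRev [] = 0
majRev (x ∷ []) = 0
majRev (x ∷ y ∷ r) = (if x <ℤ y then suc (length r) else 0) + majRev (y ∷ r)

invRev-rotate-below : ∀ x c u → (x <ℤ c) ≡ false →
  invRev (rotateBlocks (sideOf false x) c u) + countᵇ (x <ℤ_) u ≡ invRev (c ∷ u)
invRev-rotate-below x c [] _ = refl
invRev-rotate-below x c (z ∷ u) x≮c with x <ℤ z in x<?z
... | false = begin
  countᵇ (c <ℤ_) (ρ z u) + invRev (ρ z u) + countᵇ (x <ℤ_) u
    ≡⟨ cong (λ t → t + invRev (ρ z u) + countᵇ (x <ℤ_) u) (count-↭ (c <ℤ_) (rotateBlocks-↭ _ z u)) ⟩
  countᵇ (c <ℤ_) (z ∷ u) + invRev (ρ z u) + countᵇ (x <ℤ_) u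
    ≡⟨ NP.+-assoc (countᵇ (c <ℤ_) (z ∷ u)) _ _ ⟩
  countᵇ (c <ℤ_) (z ∷ u) + (invRev (ρ z u) + countᵇ (x <ℤ_) u)
    ≡⟨ cong (λ t → countᵇ (c <ℤ_) (z ∷ u) + t) (invRev-rotate-below x z u x<?z) ⟩
  countᵇ (c <ℤ_) (z ∷ u) + invRev (z ∷ u) ∎
  where
  open ≡-Reasoning
  ρ = rotateBlocks (sideOf false x)
... | true = begin
  countᵇ (z <ℤ_) (ρ c u) + invRev (ρ c u) + suc (countᵇ (x <ℤ_) u)
    ≡⟨ cong (λ t → t + invRev (ρ c u) + suc (countᵇ (x <ℤ_) u))
            (trans (count-↭ (z <ℤ_) (rotateBlocks-↭ _ c u)) (count-∷-false (z <ℤ_) c u (≥⇒<ℤ-false (ZP.<⇒≤ c<z)))) ⟩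
  countᵇ (z <ℤ_) u + invRev (ρ c u) + suc (countᵇ (x <ℤ_) u)
    ≡⟨ shuffle₁ (countᵇ (z <ℤ_) u) (invRev (ρ c u)) (countᵇ (x <ℤ_) u) ⟩
  suc (countᵇ (z <ℤ_) u + (invRev (ρ c u) + countᵇ (x <ℤ_) u))
    ≡⟨ cong (λ t → suc (countᵇ (z <ℤ_) u + t)) (invRev-rotate-below x c u x≮c) ⟩
  suc (countᵇ (z <ℤ_) u + (countᵇ (c <ℤ_) u + invRev u))
    ≡⟨ shuffle₂ (countᵇ (z <ℤ_) u) (countᵇ (c <ℤ_) u) (invRev u) ⟩
  suc (countᵇ (c <ℤ_) u) + (countᵇ (z <ℤ_) u + invRev u)
    ≡⟨ cong (_+ (countᵇ (z <ℤ_) u + invRev u)) (sym (count-∷-true (c <ℤ_) z u (<⇒<ℤ-true c<z))) ⟩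
  countᵇ (c <ℤ_) (z ∷ u) + invRev (z ∷ u) ∎
  where
  open ≡-Reasoning
  ρ = rotateBlocks (sideOf false x)
  c<z : c ℤ.< z
  c<z = ZP.≤-<-trans (<ℤ-false⇒≥ x≮c) (<ℤ-true⇒< x<?z)
  shuffle₁ : ∀ a b d → a + b + suc d ≡ suc (a + (b + d))
  shuffle₁ = solve-∀
  shuffle₂ : ∀ a b d → suc (a + (b + d)) ≡ suc b + (a + d)
  shuffle₂ = solve-∀

invRev-rotate-above : ∀ x c u → (x <ℤ c) ≡ true →
  invRev (rotateBlocks (sideOf true x) c u) ≡ invRev (c ∷ u) + countᵇ (sideOf false x) u
invRev-rotate-above x c [] _ = refl
invRev-rotate-above x c (z ∷ u) x<c with x <ℤ z in x<?z
... | true = begin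
  countᵇ (c <ℤ_) (ρ z u) + invRev (ρ z u)
    ≡⟨ cong₂ _+_ (count-↭ (c <ℤ_) (rotateBlocks-↭ _ z u)) (invRev-rotate-above x z u x<?z) ⟩
  countᵇ (c <ℤ_) (z ∷ u) + (invRev (z ∷ u) + countᵇ (sideOf false x) u)
    ≡⟨ sym (NP.+-assoc (countᵇ (c <ℤ_) (z ∷ u)) (invRev (z ∷ u)) (countᵇ (sideOf false x) u)) ⟩
  countᵇ (c <ℤ_) (z ∷ u) + invRev (z ∷ u) + countᵇ (sideOf false x) u ∎
  where
  open ≡-Reasoning
  ρ = rotateBlocks (sideOf true x)
... | false = begin
  countᵇ (z <ℤ_) (ρ c u) + invRev (ρ c u)
    ≡⟨ cong₂ _+_ (trans (count-↭ (z <ℤ_) (rotateBlocks-↭ _ c u)) (count-∷-true (z <ℤ_) c u (<⇒<ℤ-true z<c)))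
                 (invRev-rotate-above x c u x<c) ⟩
  suc (countᵇ (z <ℤ_) u) + (countᵇ (c <ℤ_) u + invRev u + countᵇ (sideOf false x) u)
    ≡⟨ shuffle (countᵇ (z <ℤ_) u) (countᵇ (c <ℤ_) u) (invRev u) (countᵇ (sideOf false x) u) ⟩
  countᵇ (c <ℤ_) u + (countᵇ (z <ℤ_) u + invRev u) + suc (countᵇ (sideOf false x) u)
    ≡⟨ cong (λ t → t + (countᵇ (z <ℤ_) u + invRev u) + suc (countᵇ (sideOf false x) u))
            (sym (count-∷-false (c <ℤ_) z u (≥⇒<ℤ-false (ZP.<⇒≤ z<c)))) ⟩
  countᵇ (c <ℤ_) (z ∷ u) + (countᵇ (z <ℤ_) u + invRev u) + suc (countᵇ (sideOf false x) u) ∎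
  where
  open ≡-Reasoning
  ρ = rotateBlocks (sideOf true x)
  z<c : z ℤ.< c
  z<c = ZP.≤-<-trans (<ℤ-false⇒≥ x<?z) (<ℤ-true⇒< x<c)
  shuffle : ∀ a b r d → suc a + (b + r + d) ≡ b + (a + r) + suc d
  shuffle = solve-∀

invRev-foataStep : ∀ x y u →
  invRev (x ∷ foataStep x (y ∷ u)) ≡ (if x <ℤ y then suc (length u) else 0) + invRev (y ∷ u)
invRev-foataStep x y u with x <ℤ y in x<?y
... | true = begin
  countᵇ (x <ℤ_) (ρ y u) + invRev (ρ y u)
    ≡⟨ cong₂ _+_ (trans (count-↭ (x <ℤ_) (rotateBlocks-↭ _ y u)) (count-∷-true (x <ℤ_) y u x<?y))
                 (invRev-rotate-above x y u x<?y) ⟩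
  suc (countᵇ (x <ℤ_) u) + (invRev (y ∷ u) + countᵇ (sideOf false x) u)
    ≡⟨ shuffle (countᵇ (x <ℤ_) u) (invRev (y ∷ u)) (countᵇ (sideOf false x) u) ⟩
  suc (countᵇ (x <ℤ_) u + countᵇ (sideOf false x) u) + invRev (y ∷ u)
    ≡⟨ cong (λ t → suc t + invRev (y ∷ u)) (count-complement (x <ℤ_) u) ⟩
  suc (length u) + invRev (y ∷ u) ∎
  where
  open ≡-Reasoning
  ρ = rotateBlocks (sideOf true x)
  shuffle : ∀ a r d → suc a + (r + d) ≡ suc (a + d) + r
  shuffle = solve-∀
... | false = begin
  countᵇ (x <ℤ_) (ρ y u) + invRev (ρ y u)
    ≡⟨ cong (_+ invRev (ρ y u)) (trans (count-↭ (x <ℤ_) (rotateBlocks-↭ _ y u)) (count-∷-false (x <ℤ_) y u x<?y)) ⟩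
  countᵇ (x <ℤ_) u + invRev (ρ y u)
    ≡⟨ NP.+-comm (countᵇ (x <ℤ_) u) (invRev (ρ y u)) ⟩
  invRev (ρ y u) + countᵇ (x <ℤ_) u
    ≡⟨ invRev-rotate-below x y u x<?y ⟩
  invRev (y ∷ u) ∎
  where
  open ≡-Reasoning
  ρ = rotateBlocks (sideOf false x)

invRev-foataRev : ∀ r → invRev (foataRev r) ≡ majRev r
invRev-foataRev [] = refl
invRev-foataRev (x ∷ []) = refl
invRev-foataRev (x ∷ y ∷ r) = begin
  invRev (x ∷ foataStep x (y ∷ u))
    ≡⟨ invRev-foataStep x y u ⟩
  (if x <ℤ y then suc (length u) else 0) + invRev (y ∷ u)
    ≡⟨ cong₂ (λ ℓ m → (if x <ℤ y then suc ℓ else 0) + m)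
             (PP.↭-length (↭-trans (foataStep-↭ y (foataRev r)) (foataRev-↭ r)))
             (invRev-foataRev (y ∷ r)) ⟩
  majRev (x ∷ y ∷ r) ∎
  where
  open ≡-Reasoning
  u = foataStep y (foataRev r)

inv-snoc : ∀ u x → inv (u ++ x ∷ []) ≡ inv u + countᵇ (x <ℤ_) u
inv-snoc [] x = refl
inv-snoc (h ∷ u) x = begin
  countᵇ (_<ℤ h) (u ++ x ∷ []) + inv (u ++ x ∷ [])
    ≡⟨ cong₂ _+_ (count-++ (_<ℤ h) u (x ∷ [])) (inv-snoc u x) ⟩
  countᵇ (_<ℤ h) u + countᵇ (_<ℤ h) (x ∷ []) + (inv u + countᵇ (x <ℤ_) u)
    ≡⟨ shuffle (countᵇ (_<ℤ h) u) (countᵇ (_<ℤ h) (x ∷ [])) (inv u) (countᵇ (x <ℤ_) u) ⟩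
  countᵇ (_<ℤ h) u + inv u + (countᵇ (_<ℤ h) (x ∷ []) + countᵇ (x <ℤ_) u)
    ≡⟨ cong (λ t → countᵇ (_<ℤ h) u + inv u + t) x-vs-h ⟩
  countᵇ (_<ℤ h) u + inv u + countᵇ (x <ℤ_) (h ∷ u) ∎
  where
  open ≡-Reasoning
  shuffle : ∀ a b r d → a + b + (r + d) ≡ a + r + (b + d)
  shuffle = solve-∀
  -- the pair (h, x) is counted on both sides exactly when x < h
  x-vs-h : countᵇ (_<ℤ h) (x ∷ []) + countᵇ (x <ℤ_) u ≡ countᵇ (x <ℤ_) (h ∷ u)
  x-vs-h with x <ℤ h
  ... | true = refl
  ... | false = refl

inv-reverse : ∀ l → inv (reverse l) ≡ invRev l
inv-reverse [] = refl
inv-reverse (x ∷ l) = begin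
  inv (reverse (x ∷ l))
    ≡⟨ cong inv (LP.unfold-reverse x l) ⟩
  inv (reverse l ++ x ∷ [])
    ≡⟨ inv-snoc (reverse l) x ⟩
  inv (reverse l) + countᵇ (x <ℤ_) (reverse l)
    ≡⟨ cong₂ _+_ (inv-reverse l) (count-↭ (x <ℤ_) (PP.↭-reverse l)) ⟩
  invRev l + countᵇ (x <ℤ_) l
    ≡⟨ NP.+-comm (invRev l) (countᵇ (x <ℤ_) l) ⟩
  invRev (x ∷ l) ∎
  where open ≡-Reasoning

-- A structural major index: majFrom k a u is maj (a ∷ u) when a sits at position k.
majFrom : ℕ → ℤ → List ℤ → ℕ
majFrom k a [] = 0
majFrom k a (b ∷ u) = (if b <ℤ a then k else 0) + majFrom (suc k) b u

majList : List ℤ → ℕ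
majList [] = 0
majList (a ∷ u) = majFrom 1 a u

majFrom-snoc : ∀ k a l y x →
  majFrom k a (l ++ y ∷ x ∷ []) ≡ majFrom k a (l ++ y ∷ []) + (if x <ℤ y then k + suc (length l) else 0)
majFrom-snoc k a [] y x = begin
  d + ((if x <ℤ y then suc k else 0) + 0)
    ≡⟨ cong₂ _+_ (sym (NP.+-identityʳ d)) (trans (NP.+-identityʳ _) (cong (λ m → if x <ℤ y then m else 0) (NP.+-comm 1 k))) ⟩
  d + 0 + (if x <ℤ y then k + 1 else 0) ∎
  where
  open ≡-Reasoning
  d = if y <ℤ a then k else 0
majFrom-snoc k a (b ∷ l) y x = begin
  d + majFrom (suc k) b (l ++ y ∷ x ∷ [])
    ≡⟨ cong (λ t → d + t) (majFrom-snoc (suc k) b l y x) ⟩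
  d + (majFrom (suc k) b (l ++ y ∷ []) + (if x <ℤ y then suc k + suc (length l) else 0))
    ≡⟨ sym (NP.+-assoc d _ _) ⟩
  d + majFrom (suc k) b (l ++ y ∷ []) + (if x <ℤ y then suc k + suc (length l) else 0)
    ≡⟨ cong (λ m → d + majFrom (suc k) b (l ++ y ∷ []) + (if x <ℤ y then m else 0)) (sym (NP.+-suc k (suc (length l)))) ⟩
  d + majFrom (suc k) b (l ++ y ∷ []) + (if x <ℤ y then k + suc (length (b ∷ l)) else 0) ∎
  where
  open ≡-Reasoning
  d = if b <ℤ a then k else 0

majList-snoc : ∀ l y x → majList (l ++ y ∷ x ∷ []) ≡ majList (l ++ y ∷ []) + (if x <ℤ y then suc (length l) else 0)
majList-snoc [] y x = NP.+-identityʳ _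
majList-snoc (a ∷ l) y x = majFrom-snoc 1 a l y x

majRev-reverse : ∀ l → majRev l ≡ majList (reverse l)
majRev-reverse [] = refl
majRev-reverse (x ∷ []) = refl
majRev-reverse (x ∷ y ∷ r) = begin
  (if x <ℤ y then suc (length r) else 0) + majRev (y ∷ r)
    ≡⟨ cong₂ (λ n m → (if x <ℤ y then suc n else 0) + m) (sym (LP.length-reverse r)) (majRev-reverse (y ∷ r)) ⟩
  (if x <ℤ y then suc (length (reverse r)) else 0) + majList (reverse (y ∷ r))
    ≡⟨ NP.+-comm _ (majList (reverse (y ∷ r))) ⟩
  majList (reverse (y ∷ r)) + (if x <ℤ y then suc (length (reverse r)) else 0)
    ≡⟨ cong (λ t → majList t + (if x <ℤ y then suc (length (reverse r)) else 0)) (LP.unfold-reverse y r) ⟩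
  majList (reverse r ++ y ∷ []) + (if x <ℤ y then suc (length (reverse r)) else 0)
    ≡⟨ sym (majList-snoc (reverse r) y x) ⟩
  majList (reverse r ++ y ∷ x ∷ [])
    ≡⟨ cong majList (sym reverse-cons₂) ⟩
  majList (reverse (x ∷ y ∷ r)) ∎
  where
  open ≡-Reasoning
  reverse-cons₂ : reverse (x ∷ y ∷ r) ≡ reverse r ++ y ∷ x ∷ []
  reverse-cons₂ = trans (LP.unfold-reverse x (y ∷ r))
    (trans (cong (_∷ʳ x) (LP.unfold-reverse y r)) (LP.++-assoc (reverse r) (y ∷ []) (x ∷ [])))

descentWeight : ℕ → List ℤ → ℕ → ℕ
descentWeight c w k = if at w (suc (suc k)) <ℤ at w (suc k) then suc c + k else 0

applyUpTo-cong : ∀ (F G : ℕ → ℕ) m → (∀ i → F i ≡ G i) → applyUpTo F m ≡ applyUpTo G m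
applyUpTo-cong F G zero h = refl
applyUpTo-cong F G (suc m) h = cong₂ _∷_ (h 0) (applyUpTo-cong (F ∘ suc) (G ∘ suc) m (h ∘ suc))

descentWeights-majFrom : ∀ c a u → sum (applyUpTo (descentWeight c (a ∷ u)) (length u)) ≡ majFrom (suc c) a u
descentWeights-majFrom c a [] = refl
descentWeights-majFrom c a (b ∷ u) = cong₂ _+_ first rest
  where
  first : descentWeight c (a ∷ b ∷ u) 0 ≡ (if b <ℤ a then suc c else 0)
  first = cong (λ m → if b <ℤ a then m else 0) (cong suc (NP.+-identityʳ c))
  rest : sum (applyUpTo (descentWeight c (a ∷ b ∷ u) ∘ suc) (length u)) ≡ majFrom (suc (suc c)) b u
  rest = trans (cong sum (applyUpTo-cong _ _ (length u)
                  (λ i → cong (λ m → if at (b ∷ u) (suc (suc i)) <ℤ at (b ∷ u) (suc i) then m else 0) (cong suc (NP.+-suc c i)))))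
               (descentWeights-majFrom (suc c) b u)

maj≡majList : ∀ w → maj (length w) w ≡ majList w
maj≡majList [] = refl
maj≡majList (a ∷ u) = trans (cong sum (LP.map-upTo (descentWeight 0 (a ∷ u)) (length u))) (descentWeights-majFrom 0 a u)

inv-foata : ∀ w → inv (foata w) ≡ maj (length w) w
inv-foata w = begin
  inv (reverse (foataRev (reverse w)))   ≡⟨ inv-reverse (foataRev (reverse w)) ⟩
  invRev (foataRev (reverse w))          ≡⟨ invRev-foataRev (reverse w) ⟩
  majRev (reverse w)                     ≡⟨ majRev-reverse (reverse w) ⟩
  majList (reverse (reverse w))          ≡⟨ cong majList (LP.reverse-involutive w) ⟩
  majList w                              ≡⟨ sym (maj≡majList w) ⟩
  maj (length w) w ∎
  where open ≡-Reasoning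

-- (3) Foata's map and relative order.  before l a b: the first occurrence of a in l precedes
-- that of b (indexOf returns the length of l for absent letters).
indexOf : List ℤ → ℤ → ℕ
indexOf [] e = 0
indexOf (z ∷ l) e = if ⌊ z ℤ.≟ e ⌋ then 0 else suc (indexOf l e)

before : List ℤ → ℤ → ℤ → Bool
before l a b = indexOf l a <ᵇ indexOf l b

≤⇒<ᵇ-false : ∀ {m n} → n ≤ m → (m <ᵇ n) ≡ false
≤⇒<ᵇ-false {m} {zero} _ = refl
≤⇒<ᵇ-false {suc m} {suc n} (s≤s n≤m) = ≤⇒<ᵇ-false n≤m

before-cons : ∀ c l l' a b → (c ≢ a → c ≢ b → before l a b ≡ before l' a b) → before (c ∷ l) a b ≡ before (c ∷ l') a b
before-cons c l l' a b h with c ℤ.≟ a | c ℤ.≟ b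
... | yes _ | yes _ = refl
... | yes _ | no _ = refl
... | no _ | yes _ = refl
... | no c≢a | no c≢b = h c≢a c≢b

-- before (c ∷ u) with the indices in u shifted once more, i.e. as if a letter other than a, b
-- were inserted right after c
before-skip : ∀ c u a b → before (c ∷ u) a b ≡
  ((if ⌊ c ℤ.≟ a ⌋ then 0 else suc (suc (indexOf u a))) <ᵇ (if ⌊ c ℤ.≟ b ⌋ then 0 else suc (suc (indexOf u b))))
before-skip c u a b with c ℤ.≟ a | c ℤ.≟ b
... | yes _ | yes _ = refl
... | yes _ | no _ = refl
... | no _ | yes _ = refl
... | no _ | no _ = refl

-- Rotating blocks keeps the order of two letters that both pass p or both fail p: block heads
-- stay in order among themselves, and so do the other letters.
rotateBlocks-before : ∀ (p : ℤ → Bool) c u a b → p c ≡ true → p a ≡ p b →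
  before (rotateBlocks p c u) a b ≡ before (c ∷ u) a b
rotateBlocks-before p c [] a b pc pab = refl
rotateBlocks-before p c (z ∷ u) a b pc pab with p z in pz
... | true = before-cons c (rotateBlocks p z u) (z ∷ u) a b (λ _ _ → rotateBlocks-before p z u a b pz pab)
... | false with z ℤ.≟ a | z ℤ.≟ b
...   | yes refl | yes refl = sym (≤⇒<ᵇ-false {if ⌊ c ℤ.≟ z ⌋ then 0 else 1} NP.≤-refl)
...   | yes refl | no z≢b with c ℤ.≟ z | c ℤ.≟ b
...     | yes refl | _ = ⊥-elim (false≢true (trans (sym pz) pc))
...     | no _ | yes refl = ⊥-elim (false≢true (trans (sym pz) (trans pab pc)))
...     | no _ | no _ = refl
rotateBlocks-before p c (z ∷ u) a b pc pab | false | no z≢a | yes refl with c ℤ.≟ a | c ℤ.≟ z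
...     | _ | yes refl = ⊥-elim (false≢true (trans (sym pz) pc))
...     | yes refl | no _ = ⊥-elim (false≢true (trans (sym pz) (trans (sym pab) pc)))
...     | no _ | no _ = refl
rotateBlocks-before p c (z ∷ u) a b pc pab | false | no z≢a | no z≢b =
  trans (rotateBlocks-before p c u a b pc pab) (before-skip c u a b)

foataStep-before : ∀ x v a b → (x <ℤ a) ≡ (x <ℤ b) → before (foataStep x v) a b ≡ before v a b
foataStep-before x [] a b h = refl
foataStep-before x (c ∷ u) a b h =
  rotateBlocks-before (sameSide x c) c u a b (sameSide-self x c) (sides (x <ℤ c))
  where
  sides : ∀ β → sideOf β x a ≡ sideOf β x b
  sides true = h
  sides false = cong not h

NoneBetween : List ℤ → ℤ → ℤ → Set
NoneBetween l a b = ∀ {z} → z ∈ l → a ℤ.< z → z ℤ.< b → ⊥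

NoneBetween-↭ : ∀ {l l' a b} → l ↭ l' → NoneBetween l a b → NoneBetween l' a b
NoneBetween-↭ p h z∈ = h (PP.∈-resp-↭ (↭-sym p) z∈)

same-side : ∀ x a b → x ≢ a → x ≢ b → NoneBetween (x ∷ []) a b → NoneBetween (x ∷ []) b a → (x <ℤ a) ≡ (x <ℤ b)
same-side x a b x≢a x≢b ab ba with x <ℤ a in x<?a | x <ℤ b in x<?b
... | true | true = refl
... | false | false = refl
... | true | false = ⊥-elim (ba (here refl) (ZP.≤∧≢⇒< (<ℤ-false⇒≥ x<?b) (λ e → x≢b (sym e))) (<ℤ-true⇒< x<?a))
... | false | true = ⊥-elim (ab (here refl) (ZP.≤∧≢⇒< (<ℤ-false⇒≥ x<?a) (λ e → x≢a (sym e))) (<ℤ-true⇒< x<?b))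

foataRev-before : ∀ r a b → NoneBetween r a b → NoneBetween r b a → before (foataRev r) a b ≡ before r a b
foataRev-before [] a b ab ba = refl
foataRev-before (x ∷ r) a b ab ba = before-cons x (foataStep x (foataRev r)) r a b (λ x≢a x≢b →
  trans (foataStep-before x (foataRev r) a b (same-side x a b x≢a x≢b (ab ∘ here₁) (ba ∘ here₁)))
        (foataRev-before r a b (ab ∘ there) (ba ∘ there)))
  where
  here₁ : ∀ {z} → z ∈ x ∷ [] → z ∈ x ∷ r
  here₁ (here e) = here e

indexOf-snoc-∈ : ∀ u x e → e ∈ u → indexOf (u ++ x ∷ []) e ≡ indexOf u e
indexOf-snoc-∈ (z ∷ u) x e e∈ with z ℤ.≟ e
... | yes _ = refl
... | no z≢e with e∈
...   | here e≡z = ⊥-elim (z≢e (sym e≡z))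
...   | there e∈u = cong suc (indexOf-snoc-∈ u x e e∈u)

indexOf-snoc-new : ∀ u x → x ∉ u → indexOf (u ++ x ∷ []) x ≡ length u
indexOf-snoc-new [] x _ with x ℤ.≟ x
... | yes _ = refl
... | no x≢x = ⊥-elim (x≢x refl)
indexOf-snoc-new (z ∷ u) x x∉ with z ℤ.≟ x
... | yes refl = ⊥-elim (x∉ (here refl))
... | no _ = cong suc (indexOf-snoc-new u x (x∉ ∘ there))

indexOf<length : ∀ u e → e ∈ u → indexOf u e < length u
indexOf<length (z ∷ u) e e∈ with z ℤ.≟ e
... | yes _ = s≤s z≤n
... | no z≢e with e∈
...   | here e≡z = ⊥-elim (z≢e (sym e≡z))
...   | there e∈u = s≤s (indexOf<length u e e∈u)

∈-tail : ∀ {x e : ℤ} {l} → x ≢ e → e ∈ x ∷ l → e ∈ l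
∈-tail x≢e (here e≡x) = ⊥-elim (x≢e (sym e≡x))
∈-tail x≢e (there e∈) = e∈

reverse-before : ∀ l a b → Unique l → a ∈ l → b ∈ l → before (reverse l) a b ≡ before l b a
reverse-before (x ∷ l) a b u@(_ ∷ ul) a∈ b∈ rewrite LP.unfold-reverse x l with x ℤ.≟ a | x ℤ.≟ b
... | yes refl | yes refl = trans (≤⇒<ᵇ-false {indexOf (reverse l ++ x ∷ []) x} NP.≤-refl) (sym (≤⇒<ᵇ-false {0} NP.≤-refl))
... | yes refl | no x≢b =
  trans (cong₂ _<ᵇ_ (indexOf-snoc-new (reverse l) x (x∉l ∘ AnyP.reverse⁻)) (indexOf-snoc-∈ (reverse l) x b b∈rl))
        (≤⇒<ᵇ-false (NP.<⇒≤ (indexOf<length (reverse l) b b∈rl)))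
  where
  x∉l = UP.Unique[x∷xs]⇒x∉xs u
  b∈rl = AnyP.reverse⁺ (∈-tail x≢b b∈)
... | no x≢a | yes refl =
  trans (cong₂ _<ᵇ_ (indexOf-snoc-∈ (reverse l) x a a∈rl) (indexOf-snoc-new (reverse l) x (x∉l ∘ AnyP.reverse⁻)))
        (T⇒≡true (NP.<⇒<ᵇ (indexOf<length (reverse l) a a∈rl)))
  where
  x∉l = UP.Unique[x∷xs]⇒x∉xs u
  a∈rl = AnyP.reverse⁺ (∈-tail x≢a a∈)
... | no x≢a | no x≢b =
  trans (cong₂ _<ᵇ_ (indexOf-snoc-∈ (reverse l) x a (AnyP.reverse⁺ (∈-tail x≢a a∈)))
                    (indexOf-snoc-∈ (reverse l) x b (AnyP.reverse⁺ (∈-tail x≢b b∈))))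
        (reverse-before l a b ul (∈-tail x≢a a∈) (∈-tail x≢b b∈))

foata-before : ∀ γ a b → Unique γ → a ∈ γ → b ∈ γ → NoneBetween γ a b → NoneBetween γ b a →
  before (foata γ) a b ≡ before γ a b
foata-before γ a b u a∈ b∈ ab ba = begin
  before (reverse (foataRev (reverse γ))) a b
    ≡⟨ reverse-before (foataRev (reverse γ)) a b (Unique-↭ γ↭ u) (PP.∈-resp-↭ γ↭ a∈) (PP.∈-resp-↭ γ↭ b∈) ⟩
  before (foataRev (reverse γ)) b a
    ≡⟨ foataRev-before (reverse γ) b a (NoneBetween-↭ γ↭rγ ba) (NoneBetween-↭ γ↭rγ ab) ⟩
  before (reverse γ) b a
    ≡⟨ reverse-before γ b a u b∈ a∈ ⟩
  before γ a b ∎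
  where
  open ≡-Reasoning
  γ↭rγ : γ ↭ reverse γ
  γ↭rγ = ↭-sym (PP.↭-reverse γ)
  γ↭ : γ ↭ foataRev (reverse γ)
  γ↭ = ↭-trans γ↭rγ (↭-sym (foataRev-↭ (reverse γ)))

occurs : ℤ → List ℤ → Bool
occurs e [] = false
occurs e (z ∷ l) = ⌊ z ℤ.≟ e ⌋ ∨ occurs e l

occurs⇒∈ : ∀ e l → occurs e l ≡ true → e ∈ l
occurs⇒∈ e (z ∷ l) h with z ℤ.≟ e
... | yes z≡e = here (sym z≡e)
... | no _ = there (occurs⇒∈ e l h)

∈⇒occurs : ∀ e l → e ∈ l → occurs e l ≡ true
∈⇒occurs e (z ∷ l) e∈ with z ℤ.≟ e
... | yes _ = refl
... | no z≢e with e∈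
...   | here e≡z = ⊥-elim (z≢e (sym e≡z))
...   | there e∈l = ∈⇒occurs e l e∈l

occurs-↭ : ∀ {l l'} → l ↭ l' → ∀ e → occurs e l ≡ occurs e l'
occurs-↭ {l} {l'} p e with occurs e l in h | occurs e l' in h'
... | true | true = refl
... | false | false = refl
... | true | false = ⊥-elim (false≢true (trans (sym h') (∈⇒occurs e l' (PP.∈-resp-↭ p (occurs⇒∈ e l h)))))
... | false | true = ⊥-elim (false≢true (trans (sym h) (∈⇒occurs e l (PP.∈-resp-↭ (↭-sym p) (occurs⇒∈ e l' h')))))

DistinctAbs : List ℤ → Set
DistinctAbs l = Unique (map ∣_∣ l)

NonZeroEntries : List ℤ → Set
NonZeroEntries l = All (_≢ + 0) l

DistinctAbs-↭ : ∀ {l l'} → l ↭ l' → DistinctAbs l → DistinctAbs l'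
DistinctAbs-↭ p = Unique-↭ (PP.map⁺ ∣_∣ p)

DistinctAbs-eq : ∀ {l x y} → DistinctAbs l → x ∈ l → y ∈ l → ∣ x ∣ ≡ ∣ y ∣ → x ≡ y
DistinctAbs-eq (_ ∷ d) (here refl) (here refl) _ = refl
DistinctAbs-eq (x∉ ∷ d) (here refl) (there y∈) e = ⊥-elim (All.lookup (AllP.map⁻ x∉) y∈ e)
DistinctAbs-eq (y∉ ∷ d) (there x∈) (here refl) e = ⊥-elim (All.lookup (AllP.map⁻ y∉) x∈ (sym e))
DistinctAbs-eq (_ ∷ d) (there x∈) (there y∈) e = DistinctAbs-eq d x∈ y∈ e

-- The entry γ⁻¹(j) of Defs' inverse is the signed position i + index of pe = +j or ne = −j.
signedPos : List ℤ → ℤ → ℤ → ℕ → ℤ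
signedPos l pe ne i =
  if occurs pe l then + (i + indexOf l pe) else (if occurs ne l then - (+ (i + indexOf l ne)) else + 0)

signedPos-suc : ∀ l pe ne i → signedPos l pe ne (suc i) ≡
  (if occurs pe l then + (i + suc (indexOf l pe)) else (if occurs ne l then - (+ (i + suc (indexOf l ne))) else + 0))
signedPos-suc l pe ne i with occurs pe l
... | true = cong +_ (sym (NP.+-suc i _))
... | false with occurs ne l
...   | true = cong (λ t → - (+ t)) (sym (NP.+-suc i _))
...   | false = refl

occurs-absent : ∀ e l k → ∣ e ∣ ≡ k → All (k ≢_) (map ∣_∣ l) → occurs e l ≡ false
occurs-absent e [] k _ _ = refl
occurs-absent e (z ∷ l) k ek (k≢z ∷ ks) with z ℤ.≟ e
... | yes refl = ⊥-elim (k≢z (sym ek))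
... | no _ = occurs-absent e l k ek ks

invAt-signedPos : ∀ l j i → DistinctAbs l → invAt l j i ≡ signedPos l (+ j) (- (+ j)) i
invAt-signedPos [] j i _ = refl
invAt-signedPos (z ∷ l) j i (z∉ ∷ d) with z ℤ.≟ + j
... | yes refl = cong +_ (sym (NP.+-identityʳ i))
... | no _ with z ℤ.≟ - (+ j)
...   | yes refl rewrite occurs-absent (+ j) l ∣ - (+ j) ∣ (sym (ZP.∣-i∣≡∣i∣ (+ j))) z∉ =
  cong (λ t → - (+ t)) (sym (NP.+-identityʳ i))
...   | no _ = trans (invAt-signedPos l j (suc i) d) (signedPos-suc l (+ j) (- (+ j)) i)

at-map-applyUpTo : ∀ (g : ℕ → ℤ) (f : ℕ → ℕ) m j → j < m → at (map g (applyUpTo f m)) (suc j) ≡ g (f j)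
at-map-applyUpTo g f (suc m) zero _ = refl
at-map-applyUpTo g f (suc m) (suc j) (s≤s j<m) = at-map-applyUpTo g (f ∘ suc) m j j<m

inverse-at : ∀ n γ j → j < n → DistinctAbs γ → at (inverse n γ) (suc j) ≡ signedPos γ (+ suc j) (- (+ suc j)) 1
inverse-at n γ j j<n d = trans (at-map-applyUpTo (λ j → invAt γ (suc j) 1) (λ k → k) n j j<n) (invAt-signedPos γ (suc j) 1 d)

pos-<ℤ-indices : ∀ k m → (+ suc k <ℤ + suc m) ≡ (k <ᵇ m)
pos-<ℤ-indices k m = compare (k <ᵇ m) refl
  where
  compare : ∀ β → (k <ᵇ m) ≡ β → (+ suc k <ℤ + suc m) ≡ β
  compare true k<?m = <⇒<ℤ-true (+<+ (s≤s (NP.<ᵇ⇒< k m (subst T (sym k<?m) tt))))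
  compare false k<?m = ≥⇒<ℤ-false (ℤ.+≤+ (s≤s (NP.≮⇒≥ (λ k<m → subst T k<?m (NP.<⇒<ᵇ k<m)))))

neg-<ℤ-indices : ∀ k m → (-[1+ k ] <ℤ -[1+ m ]) ≡ (m <ᵇ k)
neg-<ℤ-indices k m = compare (m <ᵇ k) refl
  where
  compare : ∀ β → (m <ᵇ k) ≡ β → (-[1+ k ] <ℤ -[1+ m ]) ≡ β
  compare true m<?k = <⇒<ℤ-true (-<- (NP.<ᵇ⇒< m k (subst T (sym m<?k) tt)))
  compare false m<?k = ≥⇒<ℤ-false (ℤ.-≤- (NP.≮⇒≥ (λ m<k → subst T m<?k (NP.<⇒<ᵇ m<k))))

-- Comparing γ⁻¹(j') with γ⁻¹(j) (pa, na = ±j and pb, nb = ±j') in two lists R, γ with the same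
-- letters: mixed signs are decided by the signs alone, so only the order of +j', +j or of −j, −j' matters.
signedPos-compare : ∀ R γ pa na pb nb → (∀ e → occurs e R ≡ occurs e γ) →
  (occurs pa γ ≡ true → occurs pb γ ≡ true → before R pb pa ≡ before γ pb pa) →
  (occurs pa γ ≡ false → occurs na γ ≡ true → occurs pb γ ≡ false → occurs nb γ ≡ true → before R na nb ≡ before γ na nb) →
  (signedPos R pb nb 1 <ℤ signedPos R pa na 1) ≡ (signedPos γ pb nb 1 <ℤ signedPos γ pa na 1)
signedPos-compare R γ pa na pb nb same pos neg rewrite same pa | same na | same pb | same nb
  with occurs pa γ in pa? | occurs na γ in na? | occurs pb γ in pb? | occurs nb γ in nb?
... | true | _ | true | _ = trans (pos-<ℤ-indices _ _) (trans (pos refl refl) (sym (pos-<ℤ-indices _ _)))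
... | true | _ | false | true = refl
... | true | _ | false | false = refl
... | false | true | true | _ = refl
... | false | false | true | _ = refl
... | false | true | false | true = trans (neg-<ℤ-indices _ _) (trans (neg refl refl refl refl) (sym (neg-<ℤ-indices _ _)))
... | false | true | false | false = refl
... | false | false | false | true = refl
... | false | false | false | false = refl

-- The same for the position-0 test γ⁻¹(1) < −γ⁻¹(2) (p₁, n₁ = ±1 and p₂, n₂ = ±2): only the
-- order of +1, −2 or of +2, −1 matters.
signedPos-compare-0 : ∀ R γ p₁ n₁ p₂ n₂ → (∀ e → occurs e R ≡ occurs e γ) →
  (occurs p₁ γ ≡ true → occurs p₂ γ ≡ false → occurs n₂ γ ≡ true → before R p₁ n₂ ≡ before γ p₁ n₂) →
  (occurs p₁ γ ≡ false → occurs n₁ γ ≡ true → occurs p₂ γ ≡ true → before R p₂ n₁ ≡ before γ p₂ n₁) →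
  (signedPos R p₁ n₁ 1 <ℤ - signedPos R p₂ n₂ 1) ≡ (signedPos γ p₁ n₁ 1 <ℤ - signedPos γ p₂ n₂ 1)
signedPos-compare-0 R γ p₁ n₁ p₂ n₂ same h₁ h₂ rewrite same p₁ | same n₁ | same p₂ | same n₂
  with occurs p₁ γ in p₁? | occurs n₁ γ in n₁? | occurs p₂ γ in p₂? | occurs n₂ γ in n₂?
... | true | _ | true | _ = refl
... | true | _ | false | true = trans (pos-<ℤ-indices _ _) (trans (h₁ refl refl refl) (sym (pos-<ℤ-indices _ _)))
... | true | _ | false | false = refl
... | false | true | true | _ = trans (neg-<ℤ-indices _ _) (trans (h₂ refl refl refl) (sym (neg-<ℤ-indices _ _)))
... | false | false | true | _ = refl
... | false | true | false | true = refl
... | false | true | false | false = refl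
... | false | false | false | true = refl
... | false | false | false | false = refl

NoneBetween-empty : ∀ {l a b} → b ℤ.≤ a → NoneBetween l a b
NoneBetween-empty b≤a _ a<z z<b = ZP.≤⇒≯ b≤a (ZP.<-trans a<z z<b)

NoneBetween-pos : ∀ {l} a → NoneBetween l (+ a) (+ suc a)
NoneBetween-pos a {+ k} _ (+<+ a<k) (+<+ k<sa) = NP.≤⇒≯ (NP.≤-pred k<sa) a<k

NoneBetween-neg : ∀ {l} k → NoneBetween l -[1+ suc k ] -[1+ k ]
NoneBetween-neg k { -[1+ m ]} _ (-<- m<sk) (-<- k<m) = NP.≤⇒≯ (NP.≤-pred m<sk) k<m

-- between −2 and 1 lie only −1 and 0, excluded when 1 ∈ γ
NoneBetween-−2-1 : ∀ γ → DistinctAbs γ → NonZeroEntries γ → + 1 ∈ γ → NoneBetween γ -[1+ 1 ] (+ 1)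
NoneBetween-−2-1 γ d nz 1∈ {+ zero} z∈ _ _ = All.lookup nz z∈ refl
NoneBetween-−2-1 γ d nz 1∈ {+ suc k} z∈ _ (+<+ (s≤s ()))
NoneBetween-−2-1 γ d nz 1∈ { -[1+ zero ]} z∈ _ _ with DistinctAbs-eq d z∈ 1∈ refl
... | ()
NoneBetween-−2-1 γ d nz 1∈ { -[1+ suc k ]} z∈ (-<- (s≤s ())) _

-- between −1 and 2 lie only 0 and 1, excluded when −1 ∈ γ
NoneBetween-−1-2 : ∀ γ → DistinctAbs γ → NonZeroEntries γ → -[1+ 0 ] ∈ γ → NoneBetween γ -[1+ 0 ] (+ 2)
NoneBetween-−1-2 γ d nz −1∈ {+ zero} z∈ _ _ = All.lookup nz z∈ refl
NoneBetween-−1-2 γ d nz −1∈ {+ suc zero} z∈ _ _ with DistinctAbs-eq d z∈ −1∈ refl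
... | ()
NoneBetween-−1-2 γ d nz −1∈ {+ suc (suc k)} z∈ _ (+<+ (s≤s (s≤s ())))
NoneBetween-−1-2 γ d nz −1∈ { -[1+ k ]} z∈ (-<- ()) _

desDAt-0-signedPos : ∀ n γ → 2 ≤ n → DistinctAbs γ →
  desDAt (inverse n γ) 0 ≡ (signedPos γ (+ 1) -[1+ 0 ] 1 <ℤ - signedPos γ (+ 2) -[1+ 1 ] 1)
desDAt-0-signedPos n γ n≥2 d =
  cong₂ (λ s t → s <ℤ - t) (inverse-at n γ 0 (NP.≤-trans (s≤s z≤n) n≥2) d) (inverse-at n γ 1 n≥2 d)

desDAt-suc-signedPos : ∀ n γ k → suc k < n → DistinctAbs γ →
  desDAt (inverse n γ) (suc k) ≡ (signedPos γ (+ suc (suc k)) -[1+ suc k ] 1 <ℤ signedPos γ (+ suc k) -[1+ k ] 1)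
desDAt-suc-signedPos n γ k sk<n d =
  cong₂ _<ℤ_ (inverse-at n γ (suc k) sk<n d) (inverse-at n γ k (NP.<-trans (NP.n<1+n k) sk<n) d)

SignedWindow : List ℤ → Set
SignedWindow γ = DistinctAbs γ × NonZeroEntries γ

desDAt-foata : ∀ n γ → 2 ≤ n → SignedWindow γ → ∀ j → j < n → desDAt (inverse n (foata γ)) j ≡ desDAt (inverse n γ) j
desDAt-foata n γ n≥2 (d , nz) zero _ = begin
  desDAt (inverse n (foata γ)) 0
    ≡⟨ desDAt-0-signedPos n (foata γ) n≥2 dθ ⟩
  (signedPos (foata γ) (+ 1) -[1+ 0 ] 1 <ℤ - signedPos (foata γ) (+ 2) -[1+ 1 ] 1)
    ≡⟨ signedPos-compare-0 (foata γ) γ (+ 1) -[1+ 0 ] (+ 2) -[1+ 1 ] (occurs-↭ (foata-↭ γ)) order₁ order₂ ⟩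
  (signedPos γ (+ 1) -[1+ 0 ] 1 <ℤ - signedPos γ (+ 2) -[1+ 1 ] 1)
    ≡⟨ sym (desDAt-0-signedPos n γ n≥2 d) ⟩
  desDAt (inverse n γ) 0 ∎
  where
  open ≡-Reasoning
  dθ = DistinctAbs-↭ (↭-sym (foata-↭ γ)) d
  order₁ : occurs (+ 1) γ ≡ true → occurs (+ 2) γ ≡ false → occurs -[1+ 1 ] γ ≡ true →
    before (foata γ) (+ 1) -[1+ 1 ] ≡ before γ (+ 1) -[1+ 1 ]
  order₁ 1∈ _ −2∈ = foata-before γ (+ 1) -[1+ 1 ] (UP.map⁻ d) (occurs⇒∈ _ γ 1∈) (occurs⇒∈ _ γ −2∈)
    (NoneBetween-empty ℤ.-≤+) (NoneBetween-−2-1 γ d nz (occurs⇒∈ _ γ 1∈))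
  order₂ : occurs (+ 1) γ ≡ false → occurs -[1+ 0 ] γ ≡ true → occurs (+ 2) γ ≡ true →
    before (foata γ) (+ 2) -[1+ 0 ] ≡ before γ (+ 2) -[1+ 0 ]
  order₂ _ −1∈ 2∈ = foata-before γ (+ 2) -[1+ 0 ] (UP.map⁻ d) (occurs⇒∈ _ γ 2∈) (occurs⇒∈ _ γ −1∈)
    (NoneBetween-empty ℤ.-≤+) (NoneBetween-−1-2 γ d nz (occurs⇒∈ _ γ −1∈))
desDAt-foata n γ n≥2 (d , nz) (suc k) sk<n = begin
  desDAt (inverse n (foata γ)) (suc k)
    ≡⟨ desDAt-suc-signedPos n (foata γ) k sk<n dθ ⟩
  (signedPos (foata γ) (+ suc (suc k)) -[1+ suc k ] 1 <ℤ signedPos (foata γ) (+ suc k) -[1+ k ] 1)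
    ≡⟨ signedPos-compare (foata γ) γ (+ suc k) -[1+ k ] (+ suc (suc k)) -[1+ suc k ] (occurs-↭ (foata-↭ γ)) positive negative ⟩
  (signedPos γ (+ suc (suc k)) -[1+ suc k ] 1 <ℤ signedPos γ (+ suc k) -[1+ k ] 1)
    ≡⟨ sym (desDAt-suc-signedPos n γ k sk<n d) ⟩
  desDAt (inverse n γ) (suc k) ∎
  where
  open ≡-Reasoning
  dθ = DistinctAbs-↭ (↭-sym (foata-↭ γ)) d
  positive : occurs (+ suc k) γ ≡ true → occurs (+ suc (suc k)) γ ≡ true →
    before (foata γ) (+ suc (suc k)) (+ suc k) ≡ before γ (+ suc (suc k)) (+ suc k)
  positive k+1∈ k+2∈ = foata-before γ _ _ (UP.map⁻ d) (occurs⇒∈ _ γ k+2∈) (occurs⇒∈ _ γ k+1∈)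
    (NoneBetween-empty (ℤ.+≤+ (NP.n≤1+n (suc k)))) (NoneBetween-pos (suc k))
  negative : occurs (+ suc k) γ ≡ false → occurs -[1+ k ] γ ≡ true → occurs (+ suc (suc k)) γ ≡ false → occurs -[1+ suc k ] γ ≡ true →
    before (foata γ) -[1+ k ] -[1+ suc k ] ≡ before γ -[1+ k ] -[1+ suc k ]
  negative _ −k−1∈ _ −k−2∈ = foata-before γ _ _ (UP.map⁻ d) (occurs⇒∈ _ γ −k−1∈) (occurs⇒∈ _ γ −k−2∈)
    (NoneBetween-empty (ℤ.-≤- (NP.n≤1+n k))) (NoneBetween-neg k)

DesD-inverse-foata : ∀ n γ → 2 ≤ n → SignedWindow γ → DesD n (inverse n (foata γ)) ≡ DesD n (inverse n γ)
DesD-inverse-foata n γ n≥2 w = VecP.tabulate-cong (λ i →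
  cong (λ b → if b then inside else outside) (desDAt-foata n γ n≥2 w (toℕ i) (FP.toℕ<n i)))

pairCount : (ℤ → ℤ → Bool) → List ℤ → ℕ
pairCount R [] = 0
pairCount R (x ∷ l) = countᵇ (R x) l + pairCount R l

pairCount-↭ : ∀ R → (∀ x y → R x y ≡ R y x) → ∀ {l l'} → l ↭ l' → pairCount R l ≡ pairCount R l'
pairCount-↭ R R-sym ↭-refl = refl
pairCount-↭ R R-sym (prep x p) = cong₂ _+_ (count-↭ (R x) p) (pairCount-↭ R R-sym p)
pairCount-↭ R R-sym (swap {xs = l} {ys = l'} x y p) = begin
  countᵇ (R x) (y ∷ l) + (countᵇ (R y) l + pairCount R l)
    ≡⟨ cong₂ _+_ (trans (count-∷ (R x) y l) (cong (λ t → ι (R x y) + t) (count-↭ (R x) p)))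
                 (cong₂ _+_ (count-↭ (R y) p) (pairCount-↭ R R-sym p)) ⟩
  ι (R x y) + countᵇ (R x) l' + (countᵇ (R y) l' + pairCount R l')
    ≡⟨ exchange (ι (R x y)) (countᵇ (R x) l') (countᵇ (R y) l') (pairCount R l') ⟩
  ι (R x y) + countᵇ (R y) l' + (countᵇ (R x) l' + pairCount R l')
    ≡⟨ cong (λ b → ι b + countᵇ (R y) l' + (countᵇ (R x) l' + pairCount R l')) (R-sym x y) ⟩
  ι (R y x) + countᵇ (R y) l' + (countᵇ (R x) l' + pairCount R l')
    ≡⟨ cong (_+ (countᵇ (R x) l' + pairCount R l')) (sym (count-∷ (R y) x l')) ⟩
  countᵇ (R y) (x ∷ l') + (countᵇ (R x) l' + pairCount R l') ∎
  where
  open ≡-Reasoning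
  ι : Bool → ℕ
  ι b = if b then 1 else 0
  exchange : ∀ i a b r → i + a + (b + r) ≡ i + b + (a + r)
  exchange = solve-∀
pairCount-↭ R R-sym (↭-trans p q) = trans (pairCount-↭ R R-sym p) (pairCount-↭ R R-sym q)

N2≡pairCount : ∀ l → N2 l ≡ pairCount (λ x y → (x ℤ.+ y) <ℤ + 0) l
N2≡pairCount [] = refl
N2≡pairCount (x ∷ l) = cong (λ t → countᵇ (λ y → (x ℤ.+ y) <ℤ + 0) l + t) (N2≡pairCount l)

N2-↭ : ∀ {l l'} → l ↭ l' → N2 l ≡ N2 l'
N2-↭ {l} {l'} p = begin
  N2 l                                   ≡⟨ N2≡pairCount l ⟩
  pairCount (λ x y → (x ℤ.+ y) <ℤ + 0) l  ≡⟨ pairCount-↭ _ (λ x y → cong (_<ℤ + 0) (ZP.+-comm x y)) p ⟩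
  pairCount (λ x y → (x ℤ.+ y) <ℤ + 0) l' ≡⟨ sym (N2≡pairCount l') ⟩
  N2 l' ∎
  where open ≡-Reasoning

negs≡count : ∀ l → negs l ≡ countᵇ (_<ℤ + 0) l
negs≡count [] = refl
negs≡count (x ∷ l) = trans (cong (λ t → (if x <ℤ + 0 then 1 else 0) + t) (negs≡count l)) (sym (count-∷ (_<ℤ + 0) x l))

negs-↭ : ∀ {l l'} → l ↭ l' → negs l ≡ negs l'
negs-↭ {l} {l'} p = trans (negs≡count l) (trans (count-↭ (_<ℤ + 0) p) (sym (negs≡count l')))

words-sound : ∀ n m w → w ∈ words n m → length w ≡ m × All (_∈ vals n) w
words-sound n zero w (here refl) = refl , []
words-sound n (suc m) w w∈ with MP.∈-concat⁻′ (map (λ v → map (_∷ v) (vals n)) (words n m)) w∈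
... | ws , w∈ws , ws∈ with MP.∈-map⁻ (λ v → map (_∷ v) (vals n)) ws∈
...   | v , v∈ , refl with MP.∈-map⁻ (_∷ v) w∈ws
...     | x , x∈ , refl with words-sound n m v v∈
...       | len , all = cong suc len , x∈ ∷ all

words-complete : ∀ n m w → length w ≡ m → All (_∈ vals n) w → w ∈ words n m
words-complete n zero [] _ _ = here refl
words-complete n (suc m) (x ∷ v) len (x∈ ∷ all) =
  MP.∈-concat⁺′ (MP.∈-map⁺ (_∷ v) x∈) (MP.∈-map⁺ (λ v → map (_∷ v) (vals n)) (words-complete n m v (NP.suc-injective len) all))

vals-nonzero : ∀ n {z} → z ∈ vals n → z ≢ + 0
vals-nonzero n z∈ with MP.∈-++⁻ (map (λ i → + suc i) (upTo n)) z∈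
... | inj₁ z∈pos with MP.∈-map⁻ (λ i → + suc i) z∈pos
...   | _ , _ , refl = λ ()
vals-nonzero n z∈ | inj₂ z∈neg with MP.∈-map⁻ (λ i → -[1+ i ]) z∈neg
...   | _ , _ , refl = λ ()

Unique-vals : ∀ n → Unique (vals n)
Unique-vals n = UP.++⁺ (UP.map⁺ (λ { refl → refl }) (UP.upTo⁺ n)) (UP.map⁺ (λ { refl → refl }) (UP.upTo⁺ n)) disjoint
  where
  disjoint : ∀ {v} → ¬ (v ∈ map (λ i → + suc i) (upTo n) × v ∈ map (λ i → -[1+ i ]) (upTo n))
  disjoint (p , q) with MP.∈-map⁻ (λ i → + suc i) p | MP.∈-map⁻ (λ i → -[1+ i ]) q
  ... | _ , _ , refl | _ , _ , ()

Unique-prepend : ∀ (vs : List ℤ) (ws : List (List ℤ)) → Unique vs → Unique ws →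
  Unique (concatMap (λ v → map (_∷ v) vs) ws)
Unique-prepend vs [] _ _ = []
Unique-prepend vs (w ∷ ws) uv (w∉ ∷ uw) = UP.++⁺ (UP.map⁺ LP.∷-injectiveˡ uv) (Unique-prepend vs ws uv uw) disjoint
  where
  disjoint : ∀ {z} → ¬ (z ∈ map (_∷ w) vs × z ∈ concatMap (λ v → map (_∷ v) vs) ws)
  disjoint (p , q) with MP.∈-map⁻ (_∷ w) p | MP.∈-concat⁻′ (map (λ v → map (_∷ v) vs) ws) q
  ... | x , _ , refl | zs , z∈zs , zs∈ with MP.∈-map⁻ (λ v → map (_∷ v) vs) zs∈
  ...   | v , v∈ , refl with MP.∈-map⁻ (_∷ v) z∈zs
  ...     | _ , _ , e = All.lookup w∉ v∈ (LP.∷-injectiveʳ e)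

Unique-words : ∀ n m → Unique (words n m)
Unique-words n zero = [] ∷ []
Unique-words n (suc m) = Unique-prepend (vals n) (words n m) (Unique-vals n) (Unique-words n m)

elemℕ-false⇒∉ : ∀ a l → elemℕ a l ≡ false → All (a ≢_) l
elemℕ-false⇒∉ a [] _ = []
elemℕ-false⇒∉ a (b ∷ l) e with a ℕ.≟ b
... | no a≢b = a≢b ∷ elemℕ-false⇒∉ a l e

∉⇒elemℕ-false : ∀ a l → All (a ≢_) l → elemℕ a l ≡ false
∉⇒elemℕ-false a [] _ = refl
∉⇒elemℕ-false a (b ∷ l) (a≢b ∷ a∉) with a ℕ.≟ b
... | yes a≡b = ⊥-elim (a≢b a≡b)
... | no _ = ∉⇒elemℕ-false a l a∉

distinctℕ⇒Unique : ∀ l → distinctℕ l ≡ true → Unique l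
distinctℕ⇒Unique [] _ = []
distinctℕ⇒Unique (a ∷ l) h with elemℕ a l in a∈?
... | false = elemℕ-false⇒∉ a l a∈? ∷ distinctℕ⇒Unique l h

Unique⇒distinctℕ : ∀ l → Unique l → distinctℕ l ≡ true
Unique⇒distinctℕ [] _ = refl
Unique⇒distinctℕ (a ∷ l) (a∉ ∷ u) rewrite ∉⇒elemℕ-false a l a∉ = Unique⇒distinctℕ l u

InDn : ℕ → List ℤ → Set
InDn n γ = (length γ ≡ n × All (_∈ vals n) γ) × DistinctAbs γ × isEven (negs γ) ≡ true

InDn-↭ : ∀ n {γ γ'} → γ ↭ γ' → InDn n γ → InDn n γ'
InDn-↭ n p ((len , all) , d , even) =
  (trans (sym (PP.↭-length p)) len , PP.All-resp-↭ p all) , DistinctAbs-↭ p d , trans (cong isEven (sym (negs-↭ p))) even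

InDn⇒SignedWindow : ∀ n γ → InDn n γ → SignedWindow γ
InDn⇒SignedWindow n γ ((_ , all) , d , _) = d , All.map (vals-nonzero n) all

∈DnWithInvDes⁻ : ∀ n M γ → γ ∈ DnWithInvDes n M → InDn n γ × DesD n (inverse n γ) ≡ M
∈DnWithInvDes⁻ n M γ γ∈ with MP.∈-filter⁻ (λ γ → VecP.≡-dec BoolP._≟_ (DesD n (inverse n γ)) M) γ∈
... | γ∈Dn , des with ∈-filterᵇ⁻ (λ w → isEven (negs w)) (Bn n) γ∈Dn
...   | γ∈Bn , even with ∈-filterᵇ⁻ (λ w → distinctℕ (map ∣_∣ w)) (words n n) γ∈Bn
...     | γ∈words , distinct = (words-sound n n γ γ∈words , distinctℕ⇒Unique _ distinct , even) , des

∈DnWithInvDes⁺ : ∀ n M γ → InDn n γ → DesD n (inverse n γ) ≡ M → γ ∈ DnWithInvDes n M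
∈DnWithInvDes⁺ n M γ ((len , all) , d , even) des =
  MP.∈-filter⁺ (λ γ → VecP.≡-dec BoolP._≟_ (DesD n (inverse n γ)) M)
    (∈-filterᵇ⁺ (λ w → isEven (negs w)) (Bn n)
       (∈-filterᵇ⁺ (λ w → distinctℕ (map ∣_∣ w)) (words n n) (words-complete n n γ len all) (Unique⇒distinctℕ _ d)) even)
    des

Unique-DnWithInvDes : ∀ n M → Unique (DnWithInvDes n M)
Unique-DnWithInvDes n M = UP.filter⁺ _ (UP.filter⁺ _ (UP.filter⁺ _ (Unique-words n n)))

foata-∈ : ∀ n M → 2 ≤ n → ∀ {γ} → γ ∈ DnWithInvDes n M → foata γ ∈ DnWithInvDes n M
foata-∈ n M n≥2 {γ} γ∈ with ∈DnWithInvDes⁻ n M γ γ∈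
... | inDn , des = ∈DnWithInvDes⁺ n M (foata γ) (InDn-↭ n (↭-sym (foata-↭ γ)) inDn)
  (trans (DesD-inverse-foata n γ n≥2 (InDn⇒SignedWindow n γ inDn)) des)

foata⁻¹-∈ : ∀ n M → 2 ≤ n → ∀ {γ} → γ ∈ DnWithInvDes n M → foata⁻¹ γ ∈ DnWithInvDes n M
foata⁻¹-∈ n M n≥2 {γ} γ∈ with ∈DnWithInvDes⁻ n M γ γ∈
... | inDn , des = ∈DnWithInvDes⁺ n M δ inDn-δ (begin
  DesD n (inverse n δ)          ≡⟨ sym (DesD-inverse-foata n δ n≥2 (InDn⇒SignedWindow n δ inDn-δ)) ⟩
  DesD n (inverse n (foata δ))  ≡⟨ cong (λ t → DesD n (inverse n t)) (foata-foata⁻¹ γ) ⟩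
  DesD n (inverse n γ)          ≡⟨ des ⟩
  M ∎)
  where
  open ≡-Reasoning
  δ = foata⁻¹ γ
  γ↭δ : γ ↭ δ
  γ↭δ = subst (_↭ δ) (foata-foata⁻¹ γ) (foata-↭ δ)
  inDn-δ = InDn-↭ n γ↭δ inDn

-- On D_n, foata carries dmaj to ℓ_D: maj becomes inv, and N₂ only depends on the entries.
ℓD-foata : ∀ n γ → InDn n γ → ℓD (foata γ) ≡ dmaj n γ
ℓD-foata n γ ((len , _) , _) = cong₂ _+_ (trans (inv-foata γ) (cong (λ m → maj m γ) len)) (N2-↭ (foata-↭ γ))

-- Counting dmaj on S is counting ℓ_D ∘ foata on S, which equals counting ℓ_D since foata permutes S.
corollary4p6 : (n : ℕ) → 2 ≤ n → (M : Subset n) → (k : ℕ) →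
    coeff (DnWithInvDes n M) (dmaj n) k ≡ coeff (DnWithInvDes n M) ℓD k
corollary4p6 n n≥2 M k = begin
  countᵇ (λ γ → dmaj n γ ==ℕ k) S
    ≡⟨ cong length (filter-cong _ _ S (λ γ γ∈ → cong (_==ℕ k) (sym (ℓD-foata n γ (proj₁ (∈DnWithInvDes⁻ n M γ γ∈)))))) ⟩
  countᵇ ((λ γ → ℓD γ ==ℕ k) ∘ foata) S
    ≡⟨ count-bijection foata foata⁻¹ foata⁻¹-foata foata-foata⁻¹ S (λ γ → ℓD γ ==ℕ k)
         (Unique-DnWithInvDes n M) (foata-∈ n M n≥2) (foata⁻¹-∈ n M n≥2) ⟩
  countᵇ (λ γ → ℓD γ ==ℕ k) S ∎
  where
  open ≡-Reasoning
  S = DnWithInvDes n M
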